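{- Let $1\le i<j\le n$, $\gamma_1=\alpha_i+\dots+\alpha_{j-1}+2(\alpha_j+\dots+\alpha_{n-1})+\beta$ and $\gamma_2=2(\alpha_i+\dots+\alpha_{n-1})+\beta$. Let $w\in\mathbf{W}$ with $w\le w_0$, $w(\gamma_1)<0$ and $w(\gamma_2)<0$. Then $w$ can be written as $$w=w_1'\,s_{\alpha_{j-1}}s_{\alpha_j}\cdots s_{\alpha_{n-1}}s_\beta s_{\alpha_{n-1}}\cdots s_{\alpha_{i+1}}s_{\alpha_i}\,w_2'$$ with $w_1'\le s_{\alpha_1}\cdots s_{\alpha_{j-2}}$ and $w_2'\le s_{\alpha_{i-2}}s_{\alpha_{i-3}}\cdots s_{\alpha_1}$.
   Context: $n>1$. The root system is that of $\mathrm{Sp}_{2n}$ (type $C_n$) with simple roots $\alpha_i(t)=a_i/a_{i+1}$ ($1\le i\le n-1$) and $\beta(t)=a_n^2$ for $t=\mathrm{diag}(a_1,\dots,a_n,a_n^{ -1},\dots,a_1^{ -1})$. $\mathbf{W}$ is the Weyl group, generated by the simple reflections $s_{\alpha_i}$, $s_\beta$; $\le$ is the Bruhat order ($w'\le w$ iff $w'$ is a subexpression of a reduced expression of $w$). $w_0=s_{\alpha_1}\cdots s_{\alpha_{n-1}}s_\beta s_{\alpha_{n-1}}\cdots s_{\alpha_1}$. Empty products of reflections are the identity. -}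

module Defs where

open import Data.Nat using (ℕ; zero; suc; _∸_; _≤_; _<_; _≟_)
import Data.Nat as N
open import Data.Integer using (ℤ; +_; -_; _+_; _*_)
open import Data.List using (List; []; _∷_; _++_; map; upTo; reverse; length)
open import Data.List.Relation.Unary.All using (All)
open import Data.List.Relation.Binary.Sublist.Propositional using (_⊆_)
open import Data.Product using (Σ; ∃; _×_; _,_)
open import Relation.Binary.PropositionalEquality using (_≡_)
open import Relation.Nullary using (yes; no)

-- Weight/root vectors: coordinates w.r.t. the basis e_1,...,e_n of X*(T)
-- (indexed by ℕ; only coordinates 1..n are ever nonzero/touched).
Vect : Set
Vect = ℕ → ℤ

infixl 6 _⊕_
_⊕_ : Vect → Vect → Vect
(x ⊕ y) m = x m + y m

_·_ : ℤ → Vect → Vect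
(c · x) m = c * x m

𝟎 : Vect
𝟎 _ = + 0

e : ℕ → Vect
e k m with m ≟ k
... | yes _ = + 1
... | no  _ = + 0

αv : ℕ → Vect
αv k = e k ⊕ ((- (+ 1)) · e (suc k))

βv : ℕ → Vect
βv n = (+ 2) · e n

ΣR : ℕ → ℕ → (ℕ → Vect) → Vect
ΣR a b f = Data.List.foldr (λ k acc → f k ⊕ acc) 𝟎 (map (λ t → a N.+ t) (upTo (b ∸ a)))
  where import Data.List

γ₁ : ℕ → ℕ → ℕ → Vect
γ₁ n i j = ΣR i j αv ⊕ ((+ 2) · ΣR j n αv) ⊕ βv n

γ₂ : ℕ → ℕ → Vect
γ₂ n i = ((+ 2) · ΣR i n αv) ⊕ βv n

IsNeg : ℕ → Vect → Set
IsNeg n v = Σ (ℕ → ℕ) λ c → Σ ℕ λ d →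
  ∀ m → v m ≡ - ((ΣR 1 n (λ k → (+ c k) · αv k) ⊕ ((+ d) · βv n)) m)

data Gen : Set where
  sα : ℕ → Gen
  sβ : Gen

ValidGen : ℕ → Gen → Set
ValidGen n (sα k) = 1 ≤ k × k < n
ValidGen n sβ = Data.Unit.⊤
  where import Data.Unit

ValidWord : ℕ → List Gen → Set
ValidWord n u = All (ValidGen n) u

swapAt : ℕ → Vect → Vect
swapAt k x m with m ≟ k
... | yes _ = x (suc k)
... | no  _ with m ≟ suc k
...   | yes _ = x k
...   | no  _ = x m

negAt : ℕ → Vect → Vect
negAt n x m with m ≟ n
... | yes _ = - x m
... | no  _ = x m

actGen : ℕ → Gen → Vect → Vect
actGen n (sα k) = swapAt k
actGen n sβ = negAt n

act : ℕ → List Gen → Vect → Vect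
act n [] x = x
act n (g ∷ u) x = actGen n g (act n u x)

-- two words represent the same element of W (W acts faithfully on X*(T))
_≈[_]_ : List Gen → ℕ → List Gen → Set
u ≈[ n ] v = ∀ (x : Vect) (m : ℕ) → act n u x m ≡ act n v x m

Reduced : ℕ → List Gen → Set
Reduced n u = ∀ v → ValidWord n v → v ≈[ n ] u → length u ≤ length v

_≤B[_]_ : List Gen → ℕ → List Gen → Set
w' ≤B[ n ] w = Σ (List Gen) λ u → ValidWord n u × Reduced n u × u ≈[ n ] w ×
                 Σ (List Gen) λ u' → u' ⊆ u × u' ≈[ n ] w'

-- s_{α_a} s_{α_{a+1}} ⋯ s_{α_{b-1}}  (empty if b ≤ a)
asc : ℕ → ℕ → List Gen
asc a b = map (λ t → sα (a N.+ t)) (upTo (b ∸ a))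

desc : ℕ → ℕ → List Gen
desc a b = reverse (asc a b)

w₀ : ℕ → List Gen
w₀ n = asc 1 n ++ (sβ ∷ desc 1 n)

middle : ℕ → ℕ → ℕ → List Gen
middle n i j = asc (j ∸ 1) n ++ (sβ ∷ desc i n)

module Submission where

-- The Weyl group permutes the signed basis vectors ±e_k, and the linear action of a word on e_k is
-- the signed vector given by this signed permutation (act-signed).

open import Defs
open import Data.Nat using (ℕ; zero; suc; _≤_; _<_; _∸_; _≟_; _<?_; _≤?_; z≤n; s≤s)
  renaming (_+_ to _+ⁿ_; _*_ to _*ⁿ_)
import Data.Nat.Properties as ℕP
open import Data.Integer using (ℤ; +_; -_; -[1+_]) renaming (_+_ to _+ᶻ_; _*_ to _*ᶻ_)
import Data.Integer.Properties as ℤP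
open import Data.Integer.Tactic.RingSolver using (solve-∀)
open import Data.Bool using (Bool; true; false; not)
open import Data.List using (List; []; _∷_; _++_; map; length; reverse; applyUpTo; foldr)
import Data.List.Properties as ListP
open import Data.List.Relation.Unary.All as All using (All; []; _∷_)
import Data.List.Relation.Unary.All.Properties as AllP
open import Data.List.Relation.Binary.Sublist.Propositional using (_⊆_; []; _∷_; _∷ʳ_)
open import Data.List.Relation.Binary.Sublist.Propositional.Properties using (All-resp-⊆)
open import Data.Product using (Σ; _×_; _,_; proj₁; proj₂)
open import Data.Sum using (_⊎_; inj₁; inj₂)
open import Data.Empty using (⊥; ⊥-elim)
open import Relation.Nullary using (yes; no; Dec)
open import Relation.Binary using (tri<; tri≈; tri>)
open import Relation.Binary.PropositionalEquality
open import Function using (_∘′_)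

e-diag : ∀ {k m} → m ≡ k → e k m ≡ + 1
e-diag {k} {m} m≡k with m ≟ k
... | yes _   = refl
... | no  m≢k = ⊥-elim (m≢k m≡k)

e-off : ∀ {k m} → m ≢ k → e k m ≡ + 0
e-off {k} {m} m≢k with m ≟ k
... | yes m≡k = ⊥-elim (m≢k m≡k)
... | no  _   = refl

transpose : ℕ → ℕ → ℕ
transpose t k with k ≟ t
... | yes _ = suc t
... | no  _ with k ≟ suc t
...   | yes _ = t
...   | no  _ = k

transpose-left : ∀ {t k} → k ≡ t → transpose t k ≡ suc t
transpose-left {t} {k} k≡t with k ≟ t
... | yes _   = refl
... | no  k≢t = ⊥-elim (k≢t k≡t)

transpose-right : ∀ {t k} → k ≡ suc t → transpose t k ≡ t
transpose-right {t} {k} k≡t+1 with k ≟ t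
... | yes k≡t = ⊥-elim (ℕP.1+n≢n (trans (sym k≡t+1) k≡t))
... | no  _ with k ≟ suc t
...   | yes _    = refl
...   | no  k≢t+1 = ⊥-elim (k≢t+1 k≡t+1)

transpose-other : ∀ {t k} → k ≢ t → k ≢ suc t → transpose t k ≡ k
transpose-other {t} {k} k≢t k≢t+1 with k ≟ t
... | yes k≡t = ⊥-elim (k≢t k≡t)
... | no  _ with k ≟ suc t
...   | yes k≡t+1 = ⊥-elim (k≢t+1 k≡t+1)
...   | no  _     = refl

transpose-involutive : ∀ t k → transpose t (transpose t k) ≡ k
transpose-involutive t k with k ≟ t
... | yes k≡t = trans (transpose-right refl) (sym k≡t)
... | no  k≢t with k ≟ suc t
...   | yes k≡t+1 = trans (transpose-left refl) (sym k≡t+1)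
...   | no  k≢t+1 = transpose-other k≢t k≢t+1

swapAt-transpose : ∀ t (x : Vect) → swapAt t x ≗ x ∘′ transpose t
swapAt-transpose t x m with m ≟ t
... | yes _ = refl
... | no  _ with m ≟ suc t
...   | yes _ = refl
...   | no  _ = refl

negAt-at : ∀ {n m} (x : Vect) → m ≡ n → negAt n x m ≡ - x m
negAt-at {n} {m} x m≡n with m ≟ n
... | yes _   = refl
... | no  m≢n = ⊥-elim (m≢n m≡n)

negAt-off : ∀ {n m} (x : Vect) → m ≢ n → negAt n x m ≡ x m
negAt-off {n} {m} x m≢n with m ≟ n
... | yes m≡n = ⊥-elim (m≢n m≡n)
... | no  _   = refl

e-transpose : ∀ t k → e k ∘′ transpose t ≗ e (transpose t k)
e-transpose t k m = by-cases (transpose t m ≟ k)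
  where
  by-cases : Dec (transpose t m ≡ k) → e k (transpose t m) ≡ e (transpose t k) m
  by-cases (yes τm≡k) = trans (e-diag τm≡k)
    (sym (e-diag (trans (sym (transpose-involutive t m)) (cong (transpose t) τm≡k))))
  by-cases (no τm≢k) = trans (e-off τm≢k)
    (sym (e-off (λ m≡τk → τm≢k (trans (cong (transpose t) m≡τk) (transpose-involutive t k)))))

Signed : Set
Signed = Bool × ℕ

⟦_⟧ : Signed → Vect
⟦ true  , k ⟧ = e k
⟦ false , k ⟧ m = - e k m

signed-off : ∀ s {k m} → m ≢ k → ⟦ s , k ⟧ m ≡ + 0
signed-off true  m≢k = e-off m≢k
signed-off false m≢k = cong -_ (e-off m≢k)

reflect : ℕ → Gen → Signed → Signed
reflect n (sα t) (s , k) = s , transpose t k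
reflect n sβ (s , k) with k ≟ n
... | yes _ = not s , k
... | no  _ = s , k

perm : ℕ → List Gen → Signed → Signed
perm n []      σ = σ
perm n (g ∷ u) σ = reflect n g (perm n u σ)

reflect-sβ-at : ∀ {n k} s → k ≡ n → reflect n sβ (s , k) ≡ (not s , k)
reflect-sβ-at {n} {k} s k≡n with k ≟ n
... | yes _   = refl
... | no  k≢n = ⊥-elim (k≢n k≡n)

reflect-sβ-off : ∀ {n k} s → k ≢ n → reflect n sβ (s , k) ≡ (s , k)
reflect-sβ-off {n} {k} s k≢n with k ≟ n
... | yes k≡n = ⊥-elim (k≢n k≡n)
... | no  _   = refl

perm-++ : ∀ n u v σ → perm n (u ++ v) σ ≡ perm n u (perm n v σ)
perm-++ n []      v σ = refl
perm-++ n (g ∷ u) v σ = cong (reflect n g) (perm-++ n u v σ)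

actGen-cong : ∀ n g {x y : Vect} → x ≗ y → actGen n g x ≗ actGen n g y
actGen-cong n (sα t) {x} {y} x≗y m =
  trans (swapAt-transpose t x m) (trans (x≗y (transpose t m)) (sym (swapAt-transpose t y m)))
actGen-cong n sβ {x} {y} x≗y m = by-cases (m ≟ n)
  where
  by-cases : Dec (m ≡ n) → negAt n x m ≡ negAt n y m
  by-cases (yes m≡n) = trans (negAt-at x m≡n) (trans (cong -_ (x≗y m)) (sym (negAt-at y m≡n)))
  by-cases (no  m≢n) = trans (negAt-off x m≢n) (trans (x≗y m) (sym (negAt-off y m≢n)))

act-cong : ∀ n u {x y : Vect} → x ≗ y → act n u x ≗ act n u y
act-cong n []      x≗y = x≗y
act-cong n (g ∷ u) x≗y = actGen-cong n g (act-cong n u x≗y)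

actGen-⊕ : ∀ n g (x y : Vect) → actGen n g (x ⊕ y) ≗ actGen n g x ⊕ actGen n g y
actGen-⊕ n (sα t) x y m
  rewrite swapAt-transpose t (x ⊕ y) m | swapAt-transpose t x m | swapAt-transpose t y m = refl
actGen-⊕ n sβ x y m = by-cases (m ≟ n)
  where
  by-cases : Dec (m ≡ n) → negAt n (x ⊕ y) m ≡ negAt n x m +ᶻ negAt n y m
  by-cases (yes m≡n) rewrite negAt-at (x ⊕ y) m≡n | negAt-at x m≡n | negAt-at y m≡n =
    ℤP.neg-distrib-+ (x m) (y m)
  by-cases (no m≢n) rewrite negAt-off (x ⊕ y) m≢n | negAt-off x m≢n | negAt-off y m≢n = refl

act-⊕ : ∀ n u (x y : Vect) → act n u (x ⊕ y) ≗ act n u x ⊕ act n u y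
act-⊕ n []      x y m = refl
act-⊕ n (g ∷ u) x y m =
  trans (actGen-cong n g (act-⊕ n u x y) m) (actGen-⊕ n g (act n u x) (act n u y) m)

actGen-signed : ∀ n g σ → actGen n g ⟦ σ ⟧ ≗ ⟦ reflect n g σ ⟧
actGen-signed n (sα t) (true  , k) m = trans (swapAt-transpose t (e k) m) (e-transpose t k m)
actGen-signed n (sα t) (false , k) m =
  trans (swapAt-transpose t ⟦ false , k ⟧ m) (cong -_ (e-transpose t k m))
actGen-signed n sβ (s , k) m = by-cases s (k ≟ n) (m ≟ n)
  where
  flip-off : ∀ s → m ≢ k → ⟦ s , k ⟧ m ≡ ⟦ not s , k ⟧ m
  flip-off s m≢k = trans (signed-off s m≢k) (sym (signed-off (not s) m≢k))
  by-cases : ∀ s → Dec (k ≡ n) → Dec (m ≡ n) → negAt n ⟦ s , k ⟧ m ≡ ⟦ reflect n sβ (s , k) ⟧ m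
  by-cases true  (yes k≡n) (yes m≡n) rewrite reflect-sβ-at true k≡n = negAt-at (e k) m≡n
  by-cases false (yes k≡n) (yes m≡n) rewrite reflect-sβ-at false k≡n =
    trans (negAt-at ⟦ false , k ⟧ m≡n) (ℤP.neg-involutive (e k m))
  by-cases s (yes k≡n) (no m≢n) rewrite reflect-sβ-at s k≡n =
    trans (negAt-off ⟦ s , k ⟧ m≢n) (flip-off s (λ m≡k → m≢n (trans m≡k k≡n)))
  by-cases s (no k≢n) (yes m≡n) rewrite reflect-sβ-off s k≢n =
    trans (negAt-at ⟦ s , k ⟧ m≡n)
      (trans (cong -_ (signed-off s m≢k)) (sym (signed-off s m≢k)))
    where m≢k : m ≢ k
          m≢k m≡k = k≢n (trans (sym m≡k) m≡n)
  by-cases s (no k≢n) (no m≢n) rewrite reflect-sβ-off s k≢n = negAt-off ⟦ s , k ⟧ m≢n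

act-signed : ∀ n u σ → act n u ⟦ σ ⟧ ≗ ⟦ perm n u σ ⟧
act-signed n []      σ m = refl
act-signed n (g ∷ u) σ m =
  trans (actGen-cong n g (act-signed n u σ) m) (actGen-signed n g (perm n u σ) m)

sign : Bool → ℤ
sign true  = + 1
sign false = -[1+ 0 ]

signed-diag : ∀ s k → ⟦ s , k ⟧ k ≡ sign s
signed-diag true  k = e-diag refl
signed-diag false k = cong -_ (e-diag {k} refl)

-- ⟦_⟧ is injective: the index is the support and the sign is the value there.
⟦⟧-injective : ∀ σ τ → ⟦ σ ⟧ ≗ ⟦ τ ⟧ → σ ≡ τ
⟦⟧-injective (s , k) (s' , k') σ≗τ with k ≟ k'
... | no k≢k' = ⊥-elim (sign≢0 s (trans (sym (signed-diag s k)) (trans (σ≗τ k) (signed-off s' k≢k'))))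
  where
  sign≢0 : ∀ s → sign s ≢ + 0
  sign≢0 true  ()
  sign≢0 false ()
... | yes refl = cong (_, k) (sign-injective s s' (trans (sym (signed-diag s k)) (trans (σ≗τ k) (signed-diag s' k))))
  where
  sign-injective : ∀ s s' → sign s ≡ sign s' → s ≡ s'
  sign-injective true  true  _ = refl
  sign-injective false false _ = refl
  sign-injective true  false ()
  sign-injective false true  ()

perm-respects-≈ : ∀ n u v σ → u ≈[ n ] v → perm n u σ ≡ perm n v σ
perm-respects-≈ n u v σ u≈v = ⟦⟧-injective _ _ λ m →
  trans (sym (act-signed n u σ m)) (trans (u≈v ⟦ σ ⟧ m) (act-signed n v σ m))

interval : ℕ → ℕ → List ℕ
interval a zero    = []
interval a (suc k) = a ∷ interval (suc a) k

ascW : ℕ → ℕ → List Gen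
ascW a k = map sα (interval a k)

descW : ℕ → ℕ → List Gen
descW a zero    = []
descW a (suc k) = sα (a +ⁿ k) ∷ descW a k

map-applyUpTo : ∀ {A : Set} (h h' : ℕ → A) (f : ℕ → ℕ) a k → (∀ t → h (f t) ≡ h' (a +ⁿ t)) →
                map h (applyUpTo f k) ≡ map h' (interval a k)
map-applyUpTo h h' f a zero    h∘f≡ = refl
map-applyUpTo h h' f a (suc k) h∘f≡ =
  cong₂ _∷_ (trans (h∘f≡ 0) (cong h' (ℕP.+-identityʳ a)))
    (map-applyUpTo h h' (λ t → f (suc t)) (suc a) k (λ t → trans (h∘f≡ (suc t)) (cong h' (ℕP.+-suc a t))))

asc-ascW : ∀ a b → asc a b ≡ ascW a (b ∸ a)
asc-ascW a b = map-applyUpTo (λ t → sα (a +ⁿ t)) sα (λ t → t) a (b ∸ a) (λ t → refl)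

descW-snoc : ∀ a k → descW a (suc k) ≡ descW (suc a) k ++ sα a ∷ []
descW-snoc a zero    = cong (λ b → sα b ∷ []) (ℕP.+-identityʳ a)
descW-snoc a (suc k) = cong₂ _∷_ (cong sα (ℕP.+-suc a k)) (descW-snoc a k)

reverse-ascW : ∀ a k → reverse (ascW a k) ≡ descW a k
reverse-ascW a zero    = refl
reverse-ascW a (suc k) = begin
  reverse (sα a ∷ ascW (suc a) k)         ≡⟨ ListP.unfold-reverse (sα a) (ascW (suc a) k) ⟩
  reverse (ascW (suc a) k) ++ sα a ∷ []   ≡⟨ cong (_++ sα a ∷ []) (reverse-ascW (suc a) k) ⟩
  descW (suc a) k ++ sα a ∷ []            ≡⟨ descW-snoc a k ⟨
  descW a (suc k)                         ∎
  where open ≡-Reasoning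

desc-descW : ∀ a b → desc a b ≡ descW a (b ∸ a)
desc-descW a b = trans (cong reverse (asc-ascW a b)) (reverse-ascW a (b ∸ a))

ascW-++ : ∀ a k₁ k₂ → ascW a (k₁ +ⁿ k₂) ≡ ascW a k₁ ++ ascW (a +ⁿ k₁) k₂
ascW-++ a zero     k₂ = cong (λ b → ascW b k₂) (sym (ℕP.+-identityʳ a))
ascW-++ a (suc k₁) k₂ = cong (sα a ∷_)
  (trans (ascW-++ (suc a) k₁ k₂) (cong (λ b → ascW (suc a) k₁ ++ ascW b k₂) (sym (ℕP.+-suc a k₁))))

descW-++ : ∀ a k₁ k₂ → descW a (k₂ +ⁿ k₁) ≡ descW (a +ⁿ k₁) k₂ ++ descW a k₁
descW-++ a k₁ zero     = refl
descW-++ a k₁ (suc k₂) = cong₂ _∷_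
  (cong sα (trans (cong (a +ⁿ_) (ℕP.+-comm k₂ k₁)) (sym (ℕP.+-assoc a k₁ k₂))))
  (descW-++ a k₁ k₂)

length-ascW : ∀ a k → length (ascW a k) ≡ k
length-ascW a k = trans (ListP.length-map sα (interval a k)) (length-interval a k)
  where
  length-interval : ∀ a k → length (interval a k) ≡ k
  length-interval a zero    = refl
  length-interval a (suc k) = cong suc (length-interval (suc a) k)

length-descW : ∀ a k → length (descW a k) ≡ k
length-descW a zero    = refl
length-descW a (suc k) = cong suc (length-descW a k)

perm-ascW : ∀ n a k s → perm n (ascW a k) (s , a +ⁿ k) ≡ (s , a)
perm-ascW n a zero    s = cong (s ,_) (ℕP.+-identityʳ a)
perm-ascW n a (suc k) s rewrite ℕP.+-suc a k | perm-ascW n (suc a) k s = cong (s ,_) (transpose-right refl)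

perm-descW : ∀ n a k s → perm n (descW a k) (s , a) ≡ (s , a +ⁿ k)
perm-descW n a zero    s = cong (s ,_) (sym (ℕP.+-identityʳ a))
perm-descW n a (suc k) s rewrite perm-descW n a k s =
  cong (s ,_) (trans (transpose-left refl) (sym (ℕP.+-suc a k)))

-- s_{α_t} is a letter of the band [a, b] when a ≤ t < b: it only moves indices inside [a, b].
data Letter (a b : ℕ) : Gen → Set where
  letter : ∀ {t} → a ≤ t → t < b → Letter a b (sα t)

InBand : ℕ → ℕ → List Gen → Set
InBand a b = All (Letter a b)

ascW-inBand : ∀ a k → InBand a (a +ⁿ k) (ascW a k)
ascW-inBand a zero    = []
ascW-inBand a (suc k) = letter ℕP.≤-refl (ℕP.m<m+n a (s≤s z≤n))
  ∷ All.map (λ { (letter {t} a<t t<b) → letter (ℕP.<⇒≤ a<t) (subst (t <_) (sym (ℕP.+-suc a k)) t<b) })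
      (ascW-inBand (suc a) k)

descW-inBand : ∀ a k → InBand a (a +ⁿ k) (descW a k)
descW-inBand a zero    = []
descW-inBand a (suc k) = letter (ℕP.m≤m+n a k) (subst (a +ⁿ k <_) (sym (ℕP.+-suc a k)) ℕP.≤-refl)
  ∷ All.map (λ { (letter a≤t t<b) → letter a≤t (ℕP.<-trans t<b (ℕP.+-monoʳ-< a ℕP.≤-refl)) })
      (descW-inBand a k)

inBand-valid : ∀ {n a b u} → 1 ≤ a → b ≤ n → InBand a b u → ValidWord n u
inBand-valid 1≤a b≤n = All.map (λ { (letter a≤t t<b) → ℕP.≤-trans 1≤a a≤t , ℕP.<-≤-trans t<b b≤n })

outside-untouched : ∀ {a b t p} → p < a ⊎ b < p → a ≤ t → t < b → p ≢ t × p ≢ suc t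
outside-untouched (inj₁ p<a) a≤t t<b =
  (λ { refl → ℕP.<-irrefl refl (ℕP.<-≤-trans p<a a≤t) }) , (λ { refl → ℕP.<-irrefl refl (ℕP.<-trans p<a (s≤s a≤t)) })
outside-untouched (inj₂ b<p) a≤t t<b =
  (λ { refl → ℕP.<-irrefl refl (ℕP.<-trans t<b b<p) }) , (λ { refl → ℕP.<-irrefl refl (ℕP.≤-<-trans t<b b<p) })

inBand-fixes : ∀ n {a b u} p → p < a ⊎ b < p → InBand a b u → ∀ s → perm n u (s , p) ≡ (s , p)
inBand-fixes n p outside []                    s = refl
inBand-fixes n p outside (letter a≤t t<b ∷ ls) s
  rewrite inBand-fixes n p outside ls s with outside-untouched outside a≤t t<b
... | p≢t , p≢t+1 = cong (s ,_) (transpose-other p≢t p≢t+1)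

letter-within : ∀ n {a b g} s p → a ≤ p → p ≤ b → Letter a b g →
                Σ ℕ λ p' → reflect n g (s , p) ≡ (s , p') × a ≤ p' × p' ≤ b
letter-within n {a} {b} s p a≤p p≤b (letter {t} a≤t t<b) = by-cases (p ≟ t) (p ≟ suc t)
  where
  by-cases : Dec (p ≡ t) → Dec (p ≡ suc t) → Σ ℕ λ p' → (s , transpose t p) ≡ (s , p') × a ≤ p' × p' ≤ b
  by-cases (yes p≡t) _            = suc t , cong (s ,_) (transpose-left p≡t) , ℕP.≤-trans a≤t (ℕP.n≤1+n t) , t<b
  by-cases (no _)    (yes p≡t+1)  = t , cong (s ,_) (transpose-right p≡t+1) , a≤t , ℕP.<⇒≤ t<b
  by-cases (no p≢t)  (no p≢t+1)   = p , cong (s ,_) (transpose-other p≢t p≢t+1) , a≤p , p≤b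

inBand-within : ∀ n {a b u} s p → a ≤ p → p ≤ b → InBand a b u →
                Σ ℕ λ p' → perm n u (s , p) ≡ (s , p') × a ≤ p' × p' ≤ b
inBand-within n s p a≤p p≤b [] = p , refl , a≤p , p≤b
inBand-within n s p a≤p p≤b (_∷_ {g} l ls) with inBand-within n s p a≤p p≤b ls
... | p' , eq , a≤p' , p'≤b with letter-within n s p' a≤p' p'≤b l
...   | p'' , eq' , a≤p'' , p''≤b = p'' , trans (cong (reflect n g) eq) eq' , a≤p'' , p''≤b

-- descW a k moves q+1 to q for a ≤ q < a+k (the letter s_{α_q} does it, the others fix both).
perm-descW-shift : ∀ n a k q s → a ≤ q → q < a +ⁿ k → perm n (descW a k) (s , suc q) ≡ (s , q)
perm-descW-shift n a zero q s a≤q q<a+0 =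
  ⊥-elim (ℕP.<-irrefl refl (ℕP.<-≤-trans q<a+0 (subst (_≤ q) (sym (ℕP.+-identityʳ a)) a≤q)))
perm-descW-shift n a (suc k) q s a≤q q<a+k+1
  with ℕP.m≤n⇒m<n∨m≡n (ℕP.≤-pred (subst (suc q ≤_) (ℕP.+-suc a k) q<a+k+1))
... | inj₁ q<a+k rewrite perm-descW-shift n a k q s a≤q q<a+k =
  cong (s ,_) (transpose-other (λ q≡ → ℕP.<-irrefl q≡ q<a+k) (λ q≡ → ℕP.<-irrefl q≡ (ℕP.<-trans q<a+k (ℕP.n<1+n _))))
... | inj₂ refl rewrite inBand-fixes n (suc (a +ⁿ k)) (inj₂ ℕP.≤-refl) (descW-inBand a k) s =
  cong (s ,_) (transpose-right refl)

sumOver : (ℕ → Vect) → List ℕ → Vect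
sumOver f = foldr (λ k acc → f k ⊕ acc) 𝟎

ΣR-interval : ∀ a b f → ΣR a b f ≡ sumOver f (interval a (b ∸ a))
ΣR-interval a b f = cong (sumOver f)
  (trans (map-applyUpTo (a +ⁿ_) (λ x → x) (λ t → t) a (b ∸ a) (λ t → refl)) (ListP.map-id (interval a (b ∸ a))))

-- The sum of consecutive simple roots telescopes: α_a + ⋯ + α_{a+k-1} = e_a - e_{a+k}.
sum-simpleRoots : ∀ a k m → sumOver αv (interval a k) m ≡ e a m +ᶻ - e (a +ⁿ k) m
sum-simpleRoots a zero    m rewrite ℕP.+-identityʳ a = sym (ℤP.+-inverseʳ (e a m))
sum-simpleRoots a (suc k) m rewrite sum-simpleRoots (suc a) k m | ℕP.+-suc a k =
  telescope (e a m) (e (suc a) m) (e (suc (a +ⁿ k)) m)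
  where
  telescope : ∀ x y z → (x +ᶻ (- (+ 1)) *ᶻ y) +ᶻ (y +ᶻ - z) ≡ x +ᶻ - z
  telescope = solve-∀

ΣR-simpleRoots : ∀ a b → a ≤ b → ∀ m → ΣR a b αv m ≡ e a m +ᶻ - e b m
ΣR-simpleRoots a b a≤b m = begin
  ΣR a b αv m                                 ≡⟨ cong (λ v → v m) (ΣR-interval a b αv) ⟩
  sumOver αv (interval a (b ∸ a)) m           ≡⟨ sum-simpleRoots a (b ∸ a) m ⟩
  e a m +ᶻ - e (a +ⁿ (b ∸ a)) m               ≡⟨ cong (λ c → e a m +ᶻ - e c m) (ℕP.m+[n∸m]≡n a≤b) ⟩
  e a m +ᶻ - e b m                            ∎
  where open ≡-Reasoning

γ₂-coords : ∀ n i → i ≤ n → γ₂ n i ≗ e i ⊕ e i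
γ₂-coords n i i≤n m rewrite ΣR-simpleRoots i n i≤n m = simplify (e i m) (e n m)
  where
  simplify : ∀ x z → (+ 2) *ᶻ (x +ᶻ - z) +ᶻ (+ 2) *ᶻ z ≡ x +ᶻ x
  simplify = solve-∀

γ₁-coords : ∀ n i j → i ≤ j → j ≤ n → γ₁ n i j ≗ e i ⊕ e j
γ₁-coords n i j i≤j j≤n m rewrite ΣR-simpleRoots i j i≤j m | ΣR-simpleRoots j n j≤n m =
  simplify (e i m) (e j m) (e n m)
  where
  simplify : ∀ x y z → ((x +ᶻ - y) +ᶻ (+ 2) *ᶻ (y +ᶻ - z)) +ᶻ (+ 2) *ᶻ z ≡ x +ᶻ y
  simplify = solve-∀

-- The partial sums v_1 + ⋯ + v_p of the coordinates.  Every simple root, hence every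
-- nonnegative root combination, has nonnegative partial sums; this detects non-negativity.
partialSum : ℕ → Vect → ℤ
partialSum zero    v = + 0
partialSum (suc p) v = partialSum p v +ᶻ v (suc p)

partialSum-cong : ∀ p {x y : Vect} → x ≗ y → partialSum p x ≡ partialSum p y
partialSum-cong zero    x≗y = refl
partialSum-cong (suc p) x≗y = cong₂ _+ᶻ_ (partialSum-cong p x≗y) (x≗y (suc p))

partialSum-⊕ : ∀ p (x y : Vect) → partialSum p (x ⊕ y) ≡ partialSum p x +ᶻ partialSum p y
partialSum-⊕ zero    x y = refl
partialSum-⊕ (suc p) x y rewrite partialSum-⊕ p x y =
  interchange (partialSum p x) (partialSum p y) (x (suc p)) (y (suc p))
  where
  interchange : ∀ a b c d → (a +ᶻ b) +ᶻ (c +ᶻ d) ≡ (a +ᶻ c) +ᶻ (b +ᶻ d)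
  interchange = solve-∀

partialSum-· : ∀ p c (x : Vect) → partialSum p (c · x) ≡ c *ᶻ partialSum p x
partialSum-· zero    c x = sym (ℤP.*-zeroʳ c)
partialSum-· (suc p) c x rewrite partialSum-· p c x = sym (ℤP.*-distribˡ-+ c (partialSum p x) (x (suc p)))

partialSum-neg : ∀ p (x : Vect) → partialSum p (λ m → - x m) ≡ - partialSum p x
partialSum-neg zero    x = refl
partialSum-neg (suc p) x rewrite partialSum-neg p x = sym (ℤP.neg-distrib-+ (partialSum p x) (x (suc p)))

partialSum-𝟎 : ∀ p → partialSum p 𝟎 ≡ + 0
partialSum-𝟎 zero    = refl
partialSum-𝟎 (suc p) rewrite partialSum-𝟎 p = refl

partialSum-e-before : ∀ p k → p < k → partialSum p (e k) ≡ + 0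
partialSum-e-before zero    k p<k = refl
partialSum-e-before (suc p) k p<k
  rewrite partialSum-e-before p k (ℕP.<-trans (ℕP.n<1+n p) p<k) | e-off {k} {suc p} (λ p≡k → ℕP.<-irrefl p≡k p<k) = refl

partialSum-e-after : ∀ p k → 1 ≤ k → k ≤ p → partialSum p (e k) ≡ + 1
partialSum-e-after zero    (suc k) 1≤k ()
partialSum-e-after (suc p) k 1≤k k≤p with ℕP.m≤n⇒m<n∨m≡n k≤p
... | inj₁ k<p+1 rewrite partialSum-e-after p k 1≤k (ℕP.≤-pred k<p+1)
                       | e-off {k} {suc p} (λ p≡k → ℕP.<-irrefl (sym p≡k) k<p+1) = refl
... | inj₂ refl rewrite partialSum-e-before p (suc p) ℕP.≤-refl | e-diag {suc p} {suc p} refl = refl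

NonNeg : ℤ → Set
NonNeg x = Σ ℕ λ b → x ≡ + b

NonNeg-+ : ∀ {x y} → NonNeg x → NonNeg y → NonNeg (x +ᶻ y)
NonNeg-+ (b , refl) (c , refl) = b +ⁿ c , sym (ℤP.pos-+ b c)

NonNeg-* : ∀ c {y} → NonNeg y → NonNeg (+ c *ᶻ y)
NonNeg-* c (b , refl) = c *ⁿ b , sym (ℤP.pos-* c b)

partialSum-e-nonneg : ∀ p k → NonNeg (partialSum p (e k))
partialSum-e-nonneg zero    k = 0 , refl
partialSum-e-nonneg (suc p) k = NonNeg-+ (partialSum-e-nonneg p k) (e-nonneg (suc p) k)
  where
  e-nonneg : ∀ m k → NonNeg (e k m)
  e-nonneg m k with m ≟ k
  ... | yes _ = 1 , refl
  ... | no  _ = 0 , refl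

partialSum-simpleRoot-nonneg : ∀ p t → 1 ≤ t → NonNeg (partialSum p (αv t))
partialSum-simpleRoot-nonneg p t 1≤t
  rewrite partialSum-⊕ p (e t) ((- (+ 1)) · e (suc t)) | partialSum-· p (- (+ 1)) (e (suc t))
  with ℕP.<-cmp t p
... | tri< t<p _ _ rewrite partialSum-e-after p t 1≤t (ℕP.<⇒≤ t<p) | partialSum-e-after p (suc t) (s≤s z≤n) t<p = 0 , refl
... | tri≈ _ refl _ rewrite partialSum-e-after t t 1≤t ℕP.≤-refl | partialSum-e-before t (suc t) ℕP.≤-refl = 1 , refl
... | tri> _ _ p<t rewrite partialSum-e-before p t p<t | partialSum-e-before p (suc t) (ℕP.<-trans p<t (ℕP.n<1+n t)) = 0 , refl

partialSum-sum-nonneg : ∀ p f a k → 1 ≤ a → (∀ t → 1 ≤ t → NonNeg (partialSum p (f t))) →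
                        NonNeg (partialSum p (sumOver f (interval a k)))
partialSum-sum-nonneg p f a zero    1≤a f≥0 = 0 , partialSum-𝟎 p
partialSum-sum-nonneg p f a (suc k) 1≤a f≥0 rewrite partialSum-⊕ p (f a) (sumOver f (interval (suc a) k)) =
  NonNeg-+ (f≥0 a 1≤a) (partialSum-sum-nonneg p f (suc a) k (ℕP.≤-trans 1≤a (ℕP.n≤1+n a)) f≥0)

negative-partialSum : ∀ n {v} → IsNeg n v → ∀ p → Σ ℕ λ b → partialSum p v ≡ - (+ b)
negative-partialSum n {v} (c , d , v≗-comb) p with combination-nonneg
  where
  combination : Vect
  combination = ΣR 1 n (λ k → (+ c k) · αv k) ⊕ ((+ d) · βv n)
  combination-nonneg : NonNeg (partialSum p combination)
  combination-nonneg
    rewrite partialSum-⊕ p (ΣR 1 n (λ k → (+ c k) · αv k)) ((+ d) · βv n) | ΣR-interval 1 n (λ k → (+ c k) · αv k)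
          | partialSum-· p (+ d) (βv n) | partialSum-· p (+ 2) (e n) =
    NonNeg-+ (partialSum-sum-nonneg p _ 1 (n ∸ 1) ℕP.≤-refl
                (λ t 1≤t → subst NonNeg (sym (partialSum-· p (+ c t) (αv t)))
                                 (NonNeg-* (c t) (partialSum-simpleRoot-nonneg p t 1≤t))))
             (NonNeg-* d (NonNeg-* 2 (partialSum-e-nonneg p n)))
... | b , eq = b , trans (partialSum-cong p v≗-comb) (trans (partialSum-neg p _) (cong -_ eq))

-- 2e_k (k ≥ 1) is not negative: its k-th partial sum is 2.
not-negative-double : ∀ n {v} k → IsNeg n v → v ≗ ⟦ true , k ⟧ ⊕ ⟦ true , k ⟧ → 1 ≤ k → ⊥
not-negative-double n {v} k v<0 v≗ 1≤k with negative-partialSum n v<0 k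
... | b , eq with trans (sym eq) (trans (partialSum-cong k v≗) (partialSum-⊕ k (e k) (e k)))
...   | eq' rewrite partialSum-e-after k k 1≤k ℕP.≤-refl = -b≢2 b eq'
  where
  -b≢2 : ∀ b → - (+ b) ≢ + 2
  -b≢2 zero    ()
  -b≢2 (suc b) ()

-- e_q - e_k with 1 ≤ q < k is not negative: its q-th partial sum is 1.
not-negative-ascent : ∀ n {v} k q → IsNeg n v → v ≗ ⟦ false , k ⟧ ⊕ ⟦ true , q ⟧ → 1 ≤ q → q < k → ⊥
not-negative-ascent n {v} k q v<0 v≗ 1≤q q<k with negative-partialSum n v<0 q
... | b , eq with trans (sym eq) (trans (partialSum-cong q v≗)
                   (trans (partialSum-⊕ q ⟦ false , k ⟧ (e q)) (cong (_+ᶻ partialSum q (e q)) (partialSum-neg q (e k)))))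
...   | eq' rewrite partialSum-e-after q q 1≤q ℕP.≤-refl | partialSum-e-before q k q<k = -b≢1 b eq'
  where
  -b≢1 : ∀ b → - (+ b) ≢ + 1
  -b≢1 zero    ()
  -b≢1 (suc b) ()

-- The height of a signed index along the chain +e_1, …, +e_n, -e_n, …, -e_1:
-- +e_k has height k and -e_k has height 2n+1-k.  Every letter changes the height of a
-- signed index in range by at most one.
height : ℕ → Signed → ℕ
height n (true  , k) = k
height n (false , k) = suc (n +ⁿ n) ∸ k

InRange : ℕ → Signed → Set
InRange n (s , k) = 1 ≤ k × k ≤ n

-- The letter raising height b by one: s_{α_b} below n, s_β at n, s_{α_{2n-b}} above n.
raise : ℕ → ℕ → Gen
raise n b with b <? n
... | yes _ = sα b
... | no  _ with b ≟ n
...   | yes _ = sβ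
...   | no  _ = sα ((n +ⁿ n) ∸ b)

raise-below : ∀ {n b} → b < n → raise n b ≡ sα b
raise-below {n} {b} b<n with b <? n
... | yes _   = refl
... | no  b≮n = ⊥-elim (b≮n b<n)

raise-at : ∀ {n b} → b ≡ n → raise n b ≡ sβ
raise-at {n} {b} b≡n with b <? n
... | yes b<n = ⊥-elim (ℕP.<-irrefl b≡n b<n)
... | no  _ with b ≟ n
...   | yes _   = refl
...   | no  b≢n = ⊥-elim (b≢n b≡n)

raise-above : ∀ {n b} → n < b → raise n b ≡ sα ((n +ⁿ n) ∸ b)
raise-above {n} {b} n<b with b <? n
... | yes b<n = ⊥-elim (ℕP.<-asym n<b b<n)
... | no  _ with b ≟ n
...   | yes b≡n = ⊥-elim (ℕP.<-irrefl (sym b≡n) n<b)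
...   | no  _   = refl

record HeightStep (n : ℕ) (g : Gen) (σ : Signed) : Set where
  field
    in-range  : InRange n (reflect n g σ)
    rise-≤1   : height n (reflect n g σ) ≤ suc (height n σ)
    fall-≤1   : height n σ ≤ suc (height n (reflect n g σ))
    rise-by   : height n (reflect n g σ) ≡ suc (height n σ) → g ≡ raise n (height n σ)

heightStep : ∀ {n g σ} σ' → reflect n g σ ≡ σ' → InRange n σ' →
             height n σ' ≤ suc (height n σ) → height n σ ≤ suc (height n σ') →
             (height n σ' ≡ suc (height n σ) → g ≡ raise n (height n σ)) → HeightStep n g σ
heightStep σ' refl r ≤1 ≥1 by = record { in-range = r ; rise-≤1 = ≤1 ; fall-≤1 = ≥1 ; rise-by = by }

heightStep-fixed : ∀ {n g σ} → reflect n g σ ≡ σ → InRange n σ → HeightStep n g σ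
heightStep-fixed {σ = σ} fixed r =
  heightStep σ fixed r (ℕP.n≤1+n _) (ℕP.n≤1+n _) (λ h≡h+1 → ⊥-elim (ℕP.1+n≢n (sym h≡h+1)))

heightStep-sα-positive : ∀ n t k → 1 ≤ t → t < n → 1 ≤ k → k ≤ n → HeightStep n (sα t) (true , k)
heightStep-sα-positive n t k 1≤t t<n 1≤k k≤n = by-cases (k ≟ t) (k ≟ suc t)
  where
  by-cases : Dec (k ≡ t) → Dec (k ≡ suc t) → HeightStep n (sα t) (true , k)
  by-cases (yes refl) _ =
    heightStep (true , suc t) (cong (true ,_) (transpose-left refl)) (s≤s z≤n , t<n) ℕP.≤-refl
      (ℕP.≤-trans (ℕP.n≤1+n t) (ℕP.n≤1+n (suc t))) (λ _ → sym (raise-below t<n))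
  by-cases (no _) (yes refl) =
    heightStep (true , t) (cong (true ,_) (transpose-right refl)) (1≤t , ℕP.<⇒≤ t<n)
      (ℕP.≤-trans (ℕP.n≤1+n t) (ℕP.n≤1+n (suc t))) ℕP.≤-refl
      (λ t≡t+2 → ⊥-elim (ℕP.<-irrefl t≡t+2 (ℕP.≤-trans (ℕP.n<1+n t) (ℕP.n≤1+n (suc t)))))
  by-cases (no k≢t) (no k≢t+1) = heightStep-fixed (cong (true ,_) (transpose-other k≢t k≢t+1)) (1≤k , k≤n)

heightStep-sα-negative : ∀ n t k → 1 ≤ t → t < n → 1 ≤ k → k ≤ n → HeightStep n (sα t) (false , k)
heightStep-sα-negative n t k 1≤t t<n 1≤k k≤n = by-cases (k ≟ t) (k ≟ suc t)
  where
  M : ℕ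
  M = suc (n +ⁿ n)
  below-2n : ∀ {k} → k ≤ n → k ≤ n +ⁿ n
  below-2n k≤n = ℕP.≤-trans k≤n (ℕP.m≤m+n n n)
  by-cases : Dec (k ≡ t) → Dec (k ≡ suc t) → HeightStep n (sα t) (false , k)
  by-cases (yes refl) _ =
    heightStep (false , suc t) (cong (false ,_) (transpose-left refl)) (s≤s z≤n , t<n)
      (ℕP.≤-trans (ℕP.∸-monoʳ-≤ M (ℕP.n≤1+n t)) (ℕP.n≤1+n (M ∸ t)))
      (ℕP.≤-reflexive (ℕP.+-∸-assoc 1 (below-2n (ℕP.<⇒≤ t<n))))
      (λ h≡ → ⊥-elim (ℕP.<-irrefl h≡ (s≤s (ℕP.∸-monoʳ-≤ M (ℕP.n≤1+n t)))))
  by-cases (no _) (yes refl) =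
    heightStep (false , t) (cong (false ,_) (transpose-right refl)) (1≤t , ℕP.≤-trans (ℕP.n≤1+n t) t<n)
      (ℕP.≤-reflexive (ℕP.+-∸-assoc 1 (below-2n (ℕP.≤-trans (ℕP.n≤1+n t) t<n))))
      (ℕP.≤-trans (ℕP.∸-monoʳ-≤ M (ℕP.n≤1+n t)) (ℕP.n≤1+n (M ∸ t)))
      (λ _ → sym (trans (raise-above n<h) (cong sα 2n∸h≡t)))
    where
    n<h : n < M ∸ suc t
    n<h = subst (n <_) (sym (ℕP.+-∸-assoc n {n} {t} (ℕP.<⇒≤ t<n))) (ℕP.m<m+n n (ℕP.m<n⇒0<n∸m t<n))
    2n∸h≡t : (n +ⁿ n) ∸ (M ∸ suc t) ≡ t
    2n∸h≡t = ℕP.m∸[m∸n]≡n (ℕP.≤-trans (ℕP.<⇒≤ t<n) (ℕP.m≤m+n n n))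
  by-cases (no k≢t) (no k≢t+1) = heightStep-fixed (cong (false ,_) (transpose-other k≢t k≢t+1)) (1≤k , k≤n)

heightStep-sβ : ∀ n s k → 1 ≤ k → k ≤ n → HeightStep n sβ (s , k)
heightStep-sβ n s k 1≤k k≤n = by-cases s (k ≟ n)
  where
  height-of-−n : suc (n +ⁿ n) ∸ n ≡ suc n
  height-of-−n = trans (ℕP.+-∸-assoc 1 (ℕP.m≤m+n n n)) (cong suc (ℕP.m+n∸m≡n n n))
  n<h : n < suc (suc (n +ⁿ n) ∸ n)
  n<h = subst (n <_) (cong suc (sym height-of-−n)) (ℕP.≤-trans (ℕP.n<1+n n) (ℕP.n≤1+n (suc n)))
  by-cases : ∀ s → Dec (k ≡ n) → HeightStep n sβ (s , k)
  by-cases true (yes refl) =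
    heightStep (false , n) (reflect-sβ-at true refl) (1≤k , ℕP.≤-refl) (ℕP.≤-reflexive height-of-−n)
      (ℕP.<⇒≤ n<h) (λ _ → sym (raise-at {n} {n} refl))
  by-cases false (yes refl) =
    heightStep (true , n) (reflect-sβ-at false refl) (1≤k , ℕP.≤-refl) (ℕP.<⇒≤ n<h)
      (ℕP.≤-reflexive height-of-−n) (λ n≡ → ⊥-elim (ℕP.<-irrefl n≡ n<h))
  by-cases s (no k≢n) = heightStep-fixed (reflect-sβ-off s k≢n) (1≤k , k≤n)

heightStep-valid : ∀ n g σ → ValidGen n g → InRange n σ → HeightStep n g σ
heightStep-valid n (sα t) (true  , k) (1≤t , t<n) (1≤k , k≤n) = heightStep-sα-positive n t k 1≤t t<n 1≤k k≤n
heightStep-valid n (sα t) (false , k) (1≤t , t<n) (1≤k , k≤n) = heightStep-sα-negative n t k 1≤t t<n 1≤k k≤n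
heightStep-valid n sβ     (s , k)     _           (1≤k , k≤n) = heightStep-sβ n s k 1≤k k≤n

open HeightStep

perm-in-range : ∀ n u σ → ValidWord n u → InRange n σ → InRange n (perm n u σ)
perm-in-range n []      σ _        r = r
perm-in-range n (g ∷ u) σ (v ∷ vs) r = in-range (heightStep-valid n g (perm n u σ) v (perm-in-range n u σ vs r))

perm-rise-≤ : ∀ n u σ → ValidWord n u → InRange n σ → height n (perm n u σ) ≤ height n σ +ⁿ length u
perm-rise-≤ n []      σ _        r = ℕP.m≤m+n _ 0
perm-rise-≤ n (g ∷ u) σ (v ∷ vs) r =
  ℕP.≤-trans (rise-≤1 (heightStep-valid n g (perm n u σ) v (perm-in-range n u σ vs r)))
    (subst (suc (height n (perm n u σ)) ≤_) (sym (ℕP.+-suc (height n σ) (length u))) (s≤s (perm-rise-≤ n u σ vs r)))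

perm-fall-≤ : ∀ n u σ → ValidWord n u → InRange n σ → height n σ ≤ height n (perm n u σ) +ⁿ length u
perm-fall-≤ n []      σ _        r = ℕP.m≤m+n _ 0
perm-fall-≤ n (g ∷ u) σ (v ∷ vs) r =
  ℕP.≤-trans (perm-fall-≤ n u σ vs r)
    (subst (height n (perm n u σ) +ⁿ length u ≤_) (sym (ℕP.+-suc _ (length u)))
      (ℕP.+-monoˡ-≤ (length u) (fall-≤1 (heightStep-valid n g (perm n u σ) v (perm-in-range n u σ vs r)))))

raisingWord : ℕ → ℕ → ℕ → List Gen
raisingWord n a zero    = []
raisingWord n a (suc L) = raise n (a +ⁿ L) ∷ raisingWord n a L

maximal-rise-is-raising : ∀ n u σ → ValidWord n u → InRange n σ →
                          height n (perm n u σ) ≡ height n σ +ⁿ length u → u ≡ raisingWord n (height n σ) (length u)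
maximal-rise-is-raising n []      σ _        r eq = refl
maximal-rise-is-raising n (g ∷ u) σ (v ∷ vs) r eq =
  cong₂ _∷_ (trans (rise-by step rises) (cong (raise n) partial-rise))
            (maximal-rise-is-raising n u σ vs r partial-rise)
  where
  step : HeightStep n g (perm n u σ)
  step = heightStep-valid n g (perm n u σ) v (perm-in-range n u σ vs r)
  eq' : height n (reflect n g (perm n u σ)) ≡ suc (height n σ +ⁿ length u)
  eq' = trans eq (ℕP.+-suc (height n σ) (length u))
  partial-rise : height n (perm n u σ) ≡ height n σ +ⁿ length u
  partial-rise = ℕP.≤-antisym (perm-rise-≤ n u σ vs r) (ℕP.≤-pred (ℕP.≤-trans (ℕP.≤-reflexive (sym eq')) (rise-≤1 step)))
  rises : height n (reflect n g (perm n u σ)) ≡ suc (height n (perm n u σ))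
  rises = trans eq' (cong suc (sym partial-rise))

raisingWord-++ : ∀ n a L₁ L₂ → raisingWord n a (L₂ +ⁿ L₁) ≡ raisingWord n (a +ⁿ L₁) L₂ ++ raisingWord n a L₁
raisingWord-++ n a L₁ zero     = refl
raisingWord-++ n a L₁ (suc L₂) = cong₂ _∷_
  (cong (raise n) (trans (cong (a +ⁿ_) (ℕP.+-comm L₂ L₁)) (sym (ℕP.+-assoc a L₁ L₂))))
  (raisingWord-++ n a L₁ L₂)

raisingWord-below : ∀ n' L → L ≤ n' → raisingWord (suc n') 1 L ≡ descW 1 L
raisingWord-below n' zero    _   = refl
raisingWord-below n' (suc L) L<n' =
  cong₂ _∷_ (raise-below (s≤s L<n')) (raisingWord-below n' L (ℕP.≤-trans (ℕP.n≤1+n L) L<n'))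

raisingWord-above : ∀ n L c → c +ⁿ L ≡ n → raisingWord n (suc n) L ≡ ascW c L
raisingWord-above n zero    c _      = refl
raisingWord-above n (suc L) c c+L≡n =
  cong₂ _∷_ (trans (raise-above (s≤s (ℕP.m≤m+n n L))) (cong sα 2n∸h≡c))
            (raisingWord-above n L (suc c) (trans (sym (ℕP.+-suc c L)) c+L≡n))
  where
  2n∸h≡c : (n +ⁿ n) ∸ (suc n +ⁿ L) ≡ c
  2n∸h≡c = begin
    (n +ⁿ n) ∸ (suc n +ⁿ L)   ≡⟨ cong ((n +ⁿ n) ∸_) (ℕP.+-suc n L) ⟨
    (n +ⁿ n) ∸ (n +ⁿ suc L)   ≡⟨ ℕP.[m+n]∸[m+o]≡n∸o n n (suc L) ⟩
    n ∸ suc L                 ≡⟨ cong (_∸ suc L) c+L≡n ⟨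
    (c +ⁿ suc L) ∸ suc L      ≡⟨ ℕP.m+n∸n≡m c (suc L) ⟩
    c                         ∎
    where open ≡-Reasoning

w₀W : ℕ → List Gen
w₀W n' = ascW 1 n' ++ sβ ∷ descW 1 n'

w₀-w₀W : ∀ n' → w₀ (suc n') ≡ w₀W n'
w₀-w₀W n' = cong₂ (λ a d → a ++ sβ ∷ d) (asc-ascW 1 (suc n')) (desc-descW 1 (suc n'))

-- w₀ sends +e_1 (height 1) to -e_1 (height 2n), so a valid word for it of length at most 2n-1
-- must raise the height at every letter and hence is exactly w₀W.
w₀W-unique : ∀ n' u → ValidWord (suc n') u → perm (suc n') u (true , 1) ≡ (false , 1) →
             length u ≤ n' +ⁿ suc n' → u ≡ w₀W n'
w₀W-unique n' u valid u-flips length≤ =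
  trans (maximal-rise-is-raising n u (true , 1) valid (s≤s z≤n , s≤s z≤n) full-rise)
        (trans (cong (raisingWord n 1) length≡) raising≡w₀W)
  where
  n : ℕ
  n = suc n'
  final-height : height n (perm n u (true , 1)) ≡ suc (n' +ⁿ suc n')
  final-height = cong (height n) u-flips
  length≡ : length u ≡ n' +ⁿ suc n'
  length≡ = ℕP.≤-antisym length≤
    (ℕP.≤-pred (subst (_≤ suc (length u)) final-height (perm-rise-≤ n u (true , 1) valid (s≤s z≤n , s≤s z≤n))))
  full-rise : height n (perm n u (true , 1)) ≡ 1 +ⁿ length u
  full-rise = trans final-height (cong suc (sym length≡))
  raising≡w₀W : raisingWord n 1 (n' +ⁿ suc n') ≡ w₀W n'
  raising≡w₀W = trans (raisingWord-++ n 1 (suc n') n')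
    (cong₂ _++_ (raisingWord-above n n' 1 refl) (cong₂ _∷_ (raise-at {n} {suc n'} refl) (raisingWord-below n' n' ℕP.≤-refl)))

-- ascW a k and descW a k are reduced: they move +e_{a+k} to +e_a (resp. back), a height
-- change of k, and every letter changes heights by at most one.
ascW-reduced : ∀ n a k → 1 ≤ a → a +ⁿ k ≤ n → Reduced n (ascW a k)
ascW-reduced n a k 1≤a a+k≤n v valid v≈ascW =
  subst (_≤ length v) (sym (length-ascW a k))
    (ℕP.+-cancelˡ-≤ a k (length v) (subst (λ σ → a +ⁿ k ≤ height n σ +ⁿ length v) v-lowers
      (perm-fall-≤ n v (true , a +ⁿ k) valid (ℕP.≤-trans 1≤a (ℕP.m≤m+n a k) , a+k≤n))))
  where
  v-lowers : perm n v (true , a +ⁿ k) ≡ (true , a)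
  v-lowers = trans (perm-respects-≈ n v (ascW a k) _ v≈ascW) (perm-ascW n a k true)

descW-reduced : ∀ n a k → 1 ≤ a → a +ⁿ k ≤ n → Reduced n (descW a k)
descW-reduced n a k 1≤a a+k≤n v valid v≈descW =
  subst (_≤ length v) (sym (length-descW a k))
    (ℕP.+-cancelˡ-≤ a k (length v) (subst (λ σ → height n σ ≤ a +ⁿ length v) v-raises
      (perm-rise-≤ n v (true , a) valid (1≤a , ℕP.≤-trans (ℕP.m≤m+n a k) a+k≤n))))
  where
  v-raises : perm n v (true , a) ≡ (true , a +ⁿ k)
  v-raises = trans (perm-respects-≈ n v (descW a k) _ v≈descW) (perm-descW n a k true)

w₀W-valid : ∀ n' → ValidWord (suc n') (w₀W n')
w₀W-valid n' = AllP.++⁺ (inBand-valid ℕP.≤-refl ℕP.≤-refl (ascW-inBand 1 n'))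
                        (_ ∷ inBand-valid ℕP.≤-refl ℕP.≤-refl (descW-inBand 1 n'))

w₀W-flips : ∀ n' → perm (suc n') (w₀W n') (true , 1) ≡ (false , 1)
w₀W-flips n' = begin
  perm n (w₀W n') (true , 1)                              ≡⟨ perm-++ n (ascW 1 n') (sβ ∷ descW 1 n') _ ⟩
  perm n (ascW 1 n') (reflect n sβ (perm n (descW 1 n') (true , 1)))
                                                          ≡⟨ cong (λ σ → perm n (ascW 1 n') (reflect n sβ σ)) (perm-descW n 1 n' true) ⟩
  perm n (ascW 1 n') (reflect n sβ (true , n))            ≡⟨ cong (perm n (ascW 1 n')) (reflect-sβ-at true refl) ⟩
  perm n (ascW 1 n') (false , n)                          ≡⟨ perm-ascW n 1 n' false ⟩
  (false , 1)                                             ∎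
  where
  n : ℕ
  n = suc n'
  open ≡-Reasoning

length-w₀W : ∀ n' → length (w₀W n') ≡ n' +ⁿ suc n'
length-w₀W n' = trans (ListP.length-++ (ascW 1 n'))
  (cong₂ (λ a d → a +ⁿ suc d) (length-ascW 1 n') (length-descW 1 n'))

reduced-w₀ : ∀ n' u → ValidWord (suc n') u → Reduced (suc n') u → u ≈[ suc n' ] w₀ (suc n') → u ≡ w₀W n'
reduced-w₀ n' u valid reduced u≈w₀ = w₀W-unique n' u valid u-flips length≤
  where
  u≈w₀W : u ≈[ suc n' ] w₀W n'
  u≈w₀W x m = trans (u≈w₀ x m) (cong (λ w → act (suc n') w x m) (w₀-w₀W n'))
  u-flips : perm (suc n') u (true , 1) ≡ (false , 1)
  u-flips = trans (perm-respects-≈ (suc n') u (w₀W n') _ u≈w₀W) (w₀W-flips n')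
  length≤ : length u ≤ n' +ⁿ suc n'
  length≤ = subst (length u ≤_) (length-w₀W n') (reduced (w₀W n') (w₀W-valid n') (λ x m → sym (u≈w₀W x m)))

⊆-++-split : ∀ {x : List Gen} u v → x ⊆ u ++ v →
             Σ (List Gen) λ x₁ → Σ (List Gen) λ x₂ → x ≡ x₁ ++ x₂ × x₁ ⊆ u × x₂ ⊆ v
⊆-++-split []      v x⊆v = [] , _ , refl , [] , x⊆v
⊆-++-split (g ∷ u) v (.g ∷ʳ x⊆) with ⊆-++-split u v x⊆
... | x₁ , x₂ , x≡ , x₁⊆ , x₂⊆ = x₁ , x₂ , x≡ , g ∷ʳ x₁⊆ , x₂⊆
⊆-++-split (g ∷ u) v (refl ∷ x⊆) with ⊆-++-split u v x⊆
... | x₁ , x₂ , x≡ , x₁⊆ , x₂⊆ = g ∷ x₁ , x₂ , cong (g ∷_) x≡ , refl ∷ x₁⊆ , x₂⊆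

below-top : ∀ {p a k} → p ≤ a +ⁿ k → p ≢ a +ⁿ suc k
below-top {p} {a} {k} p≤a+k p≡ = ℕP.<-irrefl p≡ (ℕP.≤-trans (s≤s p≤a+k) (ℕP.≤-reflexive (sym (ℕP.+-suc a k))))

descending-subword-climb : ∀ n a k y s → y ⊆ descW a k →
  Σ ℕ λ p → perm n y (s , a) ≡ (s , p) × a ≤ p × p ≤ a +ⁿ k × (p ≡ a +ⁿ k → y ≡ descW a k)
descending-subword-climb n a zero .[] s [] = a , refl , ℕP.≤-refl , ℕP.m≤m+n a 0 , λ _ → refl
descending-subword-climb n a (suc k) y s (._ ∷ʳ y⊆) with descending-subword-climb n a k y s y⊆
... | p , eq , a≤p , p≤a+k , _ =
  p , eq , a≤p , ℕP.≤-trans p≤a+k (ℕP.+-monoʳ-≤ a (ℕP.n≤1+n k)) , λ p≡top → ⊥-elim (below-top p≤a+k p≡top)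
descending-subword-climb n a (suc k) (._ ∷ y) s (refl ∷ y⊆) with descending-subword-climb n a k y s y⊆
... | p , eq , a≤p , p≤a+k , full = by-cases (p ≟ a +ⁿ k)
  where
  by-cases : Dec (p ≡ a +ⁿ k) → Σ ℕ λ p' → perm n (sα (a +ⁿ k) ∷ y) (s , a) ≡ (s , p') × a ≤ p' ×
             p' ≤ a +ⁿ suc k × (p' ≡ a +ⁿ suc k → sα (a +ⁿ k) ∷ y ≡ descW a (suc k))
  by-cases (yes p≡a+k) =
    suc (a +ⁿ k) , trans (cong (reflect n (sα (a +ⁿ k))) eq) (cong (s ,_) (transpose-left p≡a+k)) ,
    ℕP.≤-trans (ℕP.m≤m+n a k) (ℕP.n≤1+n _) , ℕP.≤-reflexive (sym (ℕP.+-suc a k)) ,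
    λ _ → cong (sα (a +ⁿ k) ∷_) (full p≡a+k)
  by-cases (no p≢a+k) =
    p , trans (cong (reflect n (sα (a +ⁿ k))) eq) (cong (s ,_) (transpose-other p≢a+k (λ p≡ → ℕP.<-irrefl p≡ (s≤s p≤a+k)))) ,
    a≤p , ℕP.≤-trans p≤a+k (ℕP.+-monoʳ-≤ a (ℕP.n≤1+n k)) ,
    λ p≡top → ⊥-elim (below-top p≤a+k p≡top)

descending-subword-first : ∀ n k y s → y ⊆ descW 1 (suc k) →
  (y ⊆ descW 1 k × perm n y (s , suc (suc k)) ≡ (s , suc (suc k))) ⊎ perm n y (s , suc (suc k)) ≡ (s , suc k)
descending-subword-first n k y s (._ ∷ʳ y⊆) =
  inj₁ (y⊆ , inBand-fixes n _ (inj₂ ℕP.≤-refl) (All-resp-⊆ y⊆ (descW-inBand 1 k)) s)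
descending-subword-first n k (._ ∷ y) s (refl ∷ y⊆)
  rewrite inBand-fixes n (suc (suc k)) (inj₂ ℕP.≤-refl) (All-resp-⊆ y⊆ (descW-inBand 1 k)) s =
  inj₂ (cong (s ,_) (transpose-right refl))

ascending-subword : ∀ n a k x s s' → x ⊆ ascW a k → x ≡ ascW a k ⊎
  Σ ℕ λ P → Σ ℕ λ Q → perm n x (s , a +ⁿ k) ≡ (s , P) × perm n x (s' , a) ≡ (s' , Q) × a < P × Q < P × a ≤ Q
ascending-subword n a zero .[] s s' [] = inj₁ refl
ascending-subword n a (suc k) x s s' (._ ∷ʳ x⊆) rewrite ℕP.+-suc a k
  with inBand-within n s (suc a +ⁿ k) (ℕP.m≤m+n (suc a) k) ℕP.≤-refl (All-resp-⊆ x⊆ (ascW-inBand (suc a) k))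
... | P , eq , a<P , _ =
  inj₂ (P , a , eq , inBand-fixes n a (inj₁ ℕP.≤-refl) (All-resp-⊆ x⊆ (ascW-inBand (suc a) k)) s' , a<P , a<P , ℕP.≤-refl)
ascending-subword n a (suc k) (._ ∷ x) s s' (refl ∷ x⊆) rewrite ℕP.+-suc a k
  with ascending-subword n (suc a) k x s s' x⊆
... | inj₁ x≡ = inj₁ (cong (sα a ∷_) x≡)
... | inj₂ (P , Q , eq , eq' , a+1<P , Q<P , a+1≤Q)
  rewrite eq | inBand-fixes n a (inj₁ ℕP.≤-refl) (All-resp-⊆ x⊆ (ascW-inBand (suc a) k)) s' =
  inj₂ (P , suc a ,
        cong (s ,_) (transpose-other (λ P≡a → ℕP.<-irrefl (sym P≡a) (ℕP.<-trans (ℕP.n<1+n a) a+1<P))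
                                     (λ P≡a+1 → ℕP.<-irrefl (sym P≡a+1) a+1<P)) ,
        cong (s' ,_) (transpose-left refl) , ℕP.<-trans (ℕP.n<1+n a) a+1<P , a+1<P , ℕP.n≤1+n a)

-- The two possible shapes of a subword y of s_{α_{i+k-1}} ⋯ s_{α_i} · s_{α_{i-1}} ⋯ s_{α_1}, where
-- i = k₁+1 and k = k₂: either y moves +e_i to some +e_p with p < i+k, or y is the whole
-- first segment followed by a subword y₂ of s_{α_{i-2}} ⋯ s_{α_1} (letters in the band [1, i-1]).
DescendingShape : ℕ → ℕ → ℕ → List Gen → Bool → Set
DescendingShape n k₁ k₂ y s =
  (Σ ℕ λ p → perm n y (s , suc k₁) ≡ (s , p) × 1 ≤ p × p < suc k₁ +ⁿ k₂)
  ⊎ (Σ (List Gen) λ y₂ → y ≡ descW (suc k₁) k₂ ++ y₂ × y₂ ⊆ desc 1 k₁ × InBand 1 k₁ y₂)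

descending-climb : ∀ n k₁ k₂ y₁ y₂ s → y₁ ⊆ descW (suc k₁) k₂ → perm n y₂ (s , suc k₁) ≡ (s , suc k₁) →
                   y₂ ⊆ desc 1 k₁ → InBand 1 k₁ y₂ → DescendingShape n k₁ k₂ (y₁ ++ y₂) s
descending-climb n k₁ k₂ y₁ y₂ s y₁⊆ y₂-fixes y₂⊆ y₂-band with descending-subword-climb n (suc k₁) k₂ y₁ s y₁⊆
... | p , eq , i≤p , p≤top , full with p ≟ suc k₁ +ⁿ k₂
...   | yes p≡top = inj₂ (y₂ , cong (_++ y₂) (full p≡top) , y₂⊆ , y₂-band)
...   | no  p≢top = inj₁ (p , trans (perm-++ n y₁ y₂ _) (trans (cong (perm n y₁) y₂-fixes) eq) ,
                          ℕP.≤-trans (s≤s z≤n) i≤p , ℕP.≤∧≢⇒< p≤top p≢top)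

-- Every subword of descW i k₂ ++ descW 1 (i-1) has one of the two descending shapes: if y₂
-- keeps s_{α_{i-1}} it moves +e_i to +e_{i-1}, which the upper letters fix.
descending-dichotomy : ∀ n k₁ k₂ y s → y ⊆ descW (suc k₁) k₂ ++ descW 1 k₁ → DescendingShape n k₁ k₂ y s
descending-dichotomy n zero k₂ y s y⊆ with ⊆-++-split (descW 1 k₂) [] y⊆
... | y₁ , .[] , refl , y₁⊆ , [] = descending-climb n zero k₂ y₁ [] s y₁⊆ refl [] []
descending-dichotomy n (suc k) k₂ y s y⊆ with ⊆-++-split (descW (suc (suc k)) k₂) (descW 1 (suc k)) y⊆
... | y₁ , y₂ , refl , y₁⊆ , y₂⊆ with descending-subword-first n k y₂ s y₂⊆
...   | inj₁ (y₂⊆' , y₂-fixes) =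
  descending-climb n (suc k) k₂ y₁ y₂ s y₁⊆ y₂-fixes (subst (y₂ ⊆_) (sym (desc-descW 1 (suc k))) y₂⊆')
                   (All-resp-⊆ y₂⊆' (descW-inBand 1 k))
...   | inj₂ y₂-lowers =
  inj₁ (suc k , trans (perm-++ n y₁ y₂ _) (trans (cong (perm n y₁) y₂-lowers)
                  (inBand-fixes n (suc k) (inj₁ ℕP.≤-refl) (All-resp-⊆ y₁⊆ (descW-inBand (suc (suc k)) k₂)) s)) ,
        s≤s z≤n , ℕP.m≤m+n (suc (suc k)) k₂)

ascending-dichotomy : ∀ n c k x s s' → x ⊆ ascW 1 c ++ ascW (suc c) k →
  (Σ (List Gen) λ x₁ → x ≡ x₁ ++ ascW (suc c) k × x₁ ⊆ ascW 1 c)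
  ⊎ (Σ ℕ λ P → Σ ℕ λ Q → perm n x (s , suc c +ⁿ k) ≡ (s , P) × perm n x (s' , suc c) ≡ (s' , Q) × 1 ≤ Q × Q < P)
ascending-dichotomy n c k x s s' x⊆ with ⊆-++-split (ascW 1 c) (ascW (suc c) k) x⊆
... | x₁ , x₂ , refl , x₁⊆ , x₂⊆ with ascending-subword n (suc c) k x₂ s s' x₂⊆
...   | inj₁ x₂≡ = inj₁ (x₁ , cong (x₁ ++_) x₂≡ , x₁⊆)
...   | inj₂ (P , Q , eqP , eqQ , c+1<P , Q<P , c+1≤Q) = inj₂ (move-Q (Q ≤? suc c))
  where
  -- the letters of x₁ lie in the band [1, c+1]: they fix P and keep Q below P
  x₁-band : InBand 1 (suc c) x₁
  x₁-band = All-resp-⊆ x₁⊆ (ascW-inBand 1 c)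
  image-P : perm n (x₁ ++ x₂) (s , suc c +ⁿ k) ≡ (s , P)
  image-P = trans (perm-++ n x₁ x₂ _) (trans (cong (perm n x₁) eqP) (inBand-fixes n P (inj₂ c+1<P) x₁-band s))
  move-Q : Dec (Q ≤ suc c) → Σ ℕ λ P → Σ ℕ λ Q → perm n (x₁ ++ x₂) (s , suc c +ⁿ k) ≡ (s , P) ×
           perm n (x₁ ++ x₂) (s' , suc c) ≡ (s' , Q) × 1 ≤ Q × Q < P
  move-Q (yes Q≤c+1) with inBand-within n s' Q (ℕP.≤-trans (s≤s z≤n) c+1≤Q) Q≤c+1 x₁-band
  ... | Q' , eqQ' , 1≤Q' , Q'≤c+1 =
    P , Q' , image-P , trans (perm-++ n x₁ x₂ _) (trans (cong (perm n x₁) eqQ) eqQ') , 1≤Q' , ℕP.≤-<-trans Q'≤c+1 c+1<P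
  move-Q (no Q≰c+1) =
    P , Q , image-P ,
    trans (perm-++ n x₁ x₂ _) (trans (cong (perm n x₁) eqQ) (inBand-fixes n Q (inj₂ (ℕP.≰⇒> Q≰c+1)) x₁-band s')) ,
    ℕP.≤-trans (s≤s z≤n) c+1≤Q , Q<P

-- The hypotheses w(2e_i) < 0 and w(e_i + e_j) < 0, read on the signed images of e_i and e_j:
-- w(e_i) is never some +e_k, and never w(e_i) = -e_k together with w(e_j) = +e_q, q < k.
ImageNegative : ℕ → List Gen → ℕ → Set
ImageNegative n u i = ∀ k → 1 ≤ k → perm n u (true , i) ≢ (true , k)

NoInversion : ℕ → List Gen → ℕ → ℕ → Set
NoInversion n u i j =
  ∀ k q → perm n u (true , i) ≡ (false , k) → perm n u (true , j) ≡ (true , q) → 1 ≤ q → q < k → ⊥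

-- A word of simple reflections s_{α_t} (no s_β) keeps +e_p positive, so it cannot produce
-- the image of e_i when ImageNegative holds.
positive-image : ∀ n u x i p → ImageNegative n u i → InBand 1 n x → 1 ≤ p → p ≤ n →
                 perm n u (true , i) ≡ perm n x (true , p) → ⊥
positive-image n u x i p negative x-band 1≤p p≤n eq with inBand-within n true p 1≤p p≤n x-band
... | p' , eq' , 1≤p' , _ = negative p' 1≤p' (trans eq eq')

middle-images : ∀ n'' i' j'' y₂ → i' ≤ j'' → j'' ≤ n'' → InBand 1 i' y₂ →
  let n = suc (suc n''); D = descW (suc i') (suc n'' ∸ i') in
  perm n (sβ ∷ D ++ y₂) (true , suc i') ≡ (false , n) × perm n (sβ ∷ D ++ y₂) (true , suc (suc j'')) ≡ (true , suc j'')
middle-images n'' i' j'' y₂ i'≤j'' j''≤n'' y₂-band =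
  (begin
    reflect n sβ (perm n (D ++ y₂) (true , i))        ≡⟨ cong (reflect n sβ) (perm-++ n D y₂ _) ⟩
    reflect n sβ (perm n D (perm n y₂ (true , i)))    ≡⟨ cong (λ σ → reflect n sβ (perm n D σ)) (fixes i ℕP.≤-refl) ⟩
    reflect n sβ (perm n D (true , i))                ≡⟨ cong (reflect n sβ) (perm-descW n i (n' ∸ i') true) ⟩
    reflect n sβ (true , i +ⁿ (n' ∸ i'))              ≡⟨ reflect-sβ-at true top ⟩
    (false , i +ⁿ (n' ∸ i'))                          ≡⟨ cong (false ,_) top ⟩
    (false , n)                                       ∎) ,
  (begin
    reflect n sβ (perm n (D ++ y₂) (true , j))        ≡⟨ cong (reflect n sβ) (perm-++ n D y₂ _) ⟩
    reflect n sβ (perm n D (perm n y₂ (true , j)))    ≡⟨ cong (λ σ → reflect n sβ (perm n D σ)) (fixes j i≤j) ⟩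
    reflect n sβ (perm n D (true , j))                ≡⟨ cong (reflect n sβ) D-shifts-j ⟩
    reflect n sβ (true , suc j'')                     ≡⟨ reflect-sβ-off true j-1≢n ⟩
    (true , suc j'')                                  ∎)
  where
  open ≡-Reasoning
  n' n i j : ℕ
  n' = suc n''
  n = suc n'
  i = suc i'
  j = suc (suc j'')
  i≤j : i ≤ j
  i≤j = s≤s (ℕP.≤-trans i'≤j'' (ℕP.n≤1+n j''))
  D : List Gen
  D = descW i (n' ∸ i')
  top : i +ⁿ (n' ∸ i') ≡ n
  top = cong suc (ℕP.m+[n∸m]≡n (ℕP.≤-trans i'≤j'' (ℕP.≤-trans j''≤n'' (ℕP.n≤1+n n''))))
  j-1≢n : suc j'' ≢ n
  j-1≢n j-1≡n = ℕP.<-irrefl j-1≡n (s≤s (s≤s j''≤n''))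
  D-shifts-j : perm n D (true , j) ≡ (true , suc j'')
  D-shifts-j = perm-descW-shift n i (n' ∸ i') (suc j'') true (s≤s i'≤j'') (subst (suc j'' <_) (sym top) (s≤s (s≤s j''≤n'')))
  fixes : ∀ p → suc i' ≤ p → perm n y₂ (true , p) ≡ (true , p)
  fixes p i≤p = inBand-fixes n p (inj₂ i≤p) y₂-band true

record MiddleShape (n i j : ℕ) (u : List Gen) : Set where
  constructor middleShape
  field
    left right    : List Gen
    left-⊆        : left ⊆ asc 1 (j ∸ 1)
    right-⊆       : right ⊆ desc 1 (i ∸ 1)
    decomposition : u ≡ left ++ middle n i j ++ right

-- The heart of the proof: a subword u of w₀W satisfying both negativity conditions has the
-- shape x₁ · middle · y₂ with x₁ ⊆ s_{α_1} ⋯ s_{α_{j-2}} and y₂ ⊆ s_{α_{i-2}} ⋯ s_{α_1}.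
--   * u must keep s_β, otherwise it preserves the sign of e_i;
--   * then the descending part must contain all of s_{α_{n-1}} ⋯ s_{α_i}, otherwise it carries +e_i to some
--     +e_p with p < n, fixed by s_β;
--   * now e_i ↦ -e_n and e_j ↦ +e_{j-1} after s_β, and the ascending part must contain all of
--     s_{α_{j-1}} ⋯ s_{α_{n-1}}, otherwise the final images form an inversion.
-- Here n = n''+2, i = i'+1 and j = j''+2.
module _ (n'' i' j'' : ℕ) (i'≤j'' : i' ≤ j'') (j''≤n'' : j'' ≤ n'') where

  private
    n' n i j : ℕ
    n' = suc n''
    n  = suc n'
    i  = suc i'
    j  = suc (suc j'')
    i'≤n' : i' ≤ n'
    i'≤n' = ℕP.≤-trans i'≤j'' (ℕP.≤-trans j''≤n'' (ℕP.n≤1+n n''))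
    j''≤n' : j'' ≤ n'
    j''≤n' = ℕP.≤-trans j''≤n'' (ℕP.n≤1+n n'')
    descW-split : descW 1 n' ≡ descW i (n' ∸ i') ++ descW 1 i'
    descW-split = trans (cong (descW 1) (sym (ℕP.m∸n+n≡m i'≤n'))) (descW-++ 1 i' (n' ∸ i'))
    ascW-split : ascW 1 n' ≡ ascW 1 j'' ++ ascW (suc j'') (n' ∸ j'')
    ascW-split = trans (cong (ascW 1) (sym (ℕP.m+[n∸m]≡n j''≤n'))) (ascW-++ 1 j'' (n' ∸ j''))
    top-i : i +ⁿ (n' ∸ i') ≡ n
    top-i = cong suc (ℕP.m+[n∸m]≡n i'≤n')
    top-j : suc j'' +ⁿ (n' ∸ j'') ≡ n
    top-j = cong suc (ℕP.m+[n∸m]≡n j''≤n')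
    middle-W : middle n i j ≡ ascW (suc j'') (n' ∸ j'') ++ sβ ∷ descW i (n' ∸ i')
    middle-W = cong₂ (λ a d → a ++ sβ ∷ d) (asc-ascW (suc j'') n) (desc-descW i n)
    regroup : ∀ x₁ y₂ → (x₁ ++ ascW (suc j'') (n' ∸ j'')) ++ sβ ∷ (descW i (n' ∸ i') ++ y₂) ≡ x₁ ++ middle n i j ++ y₂
    regroup x₁ y₂ = begin
      (x₁ ++ A) ++ sβ ∷ (D ++ y₂)   ≡⟨ ListP.++-assoc x₁ A (sβ ∷ (D ++ y₂)) ⟩
      x₁ ++ (A ++ sβ ∷ (D ++ y₂))   ≡⟨ cong (x₁ ++_) (ListP.++-assoc A (sβ ∷ D) y₂) ⟨
      x₁ ++ (A ++ sβ ∷ D) ++ y₂     ≡⟨ cong (λ m → x₁ ++ m ++ y₂) middle-W ⟨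
      x₁ ++ middle n i j ++ y₂      ∎
      where
      open ≡-Reasoning
      A D : List Gen
      A = ascW (suc j'') (n' ∸ j'')
      D = descW i (n' ∸ i')

  w₀-subword-shape : ∀ u → ImageNegative n u i → NoInversion n u i j → u ⊆ w₀W n' → MiddleShape n i j u
  w₀-subword-shape u negative no-inversion u⊆ with ⊆-++-split (ascW 1 n') (sβ ∷ descW 1 n') u⊆
  ... | x , v , refl , x⊆ , (.sβ ∷ʳ v⊆) =
    ⊥-elim (positive-image n (x ++ v) (x ++ v) i i negative
              (AllP.++⁺ (All-resp-⊆ x⊆ (ascW-inBand 1 n')) (All-resp-⊆ v⊆ (descW-inBand 1 n')))
              (s≤s z≤n) (s≤s i'≤n') refl)
  ... | x , .(sβ ∷ y) , refl , x⊆ , (_∷_ {xs = y} refl y⊆)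
    with descending-dichotomy n i' (n' ∸ i') y true (subst (y ⊆_) descW-split y⊆)
  ...   | inj₁ (p , eq , 1≤p , p<top) =
    ⊥-elim (positive-image n (x ++ sβ ∷ y) x i p negative (All-resp-⊆ x⊆ (ascW-inBand 1 n')) 1≤p
              (ℕP.≤-trans (ℕP.<⇒≤ p<top) (ℕP.≤-reflexive top-i))
              (trans (perm-++ n x (sβ ∷ y) _) (cong (perm n x) (trans (cong (reflect n sβ) eq) (reflect-sβ-off true p≢n)))))
    where
    p≢n : p ≢ n
    p≢n p≡n = ℕP.<-irrefl (trans p≡n (sym top-i)) p<top
  ...   | inj₂ (y₂ , refl , y₂⊆ , y₂-band)
    with ascending-dichotomy n j'' (n' ∸ j'') x false true (subst (x ⊆_) ascW-split x⊆)
  ...     | inj₁ (x₁ , refl , x₁⊆) =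
    middleShape x₁ y₂ (subst (x₁ ⊆_) (sym (asc-ascW 1 (suc j''))) x₁⊆) y₂⊆ (regroup x₁ y₂)
  ...     | inj₂ (P , Q , eqP , eqQ , 1≤Q , Q<P) = ⊥-elim (no-inversion P Q image-i image-j 1≤Q Q<P)
    where
    w : List Gen
    w = sβ ∷ descW i (n' ∸ i') ++ y₂
    after-middle : perm n w (true , i) ≡ (false , n) × perm n w (true , j) ≡ (true , suc j'')
    after-middle = middle-images n'' i' j'' y₂ i'≤j'' j''≤n'' y₂-band
    image-i : perm n (x ++ w) (true , i) ≡ (false , P)
    image-i = trans (perm-++ n x w _)
      (trans (cong (perm n x) (proj₁ after-middle)) (trans (cong (λ m → perm n x (false , m)) (sym top-j)) eqP))
    image-j : perm n (x ++ w) (true , j) ≡ (true , Q)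
    image-j = trans (perm-++ n x w _) (trans (cong (perm n x) (proj₂ after-middle)) eqQ)

ValidReduced : ℕ → List Gen → Set
ValidReduced n v = ValidWord n v × Reduced n v

asc-valid-reduced : ∀ n b → b < n → ValidReduced n (asc 1 b)
asc-valid-reduced n b b<n rewrite asc-ascW 1 b =
  inBand-valid ℕP.≤-refl bound (ascW-inBand 1 (b ∸ 1)) , ascW-reduced n 1 (b ∸ 1) ℕP.≤-refl bound
  where
  bound : 1 +ⁿ (b ∸ 1) ≤ n
  bound = ℕP.≤-trans (s≤s (ℕP.m∸n≤m b 1)) b<n

desc-valid-reduced : ∀ n b → b < n → ValidReduced n (desc 1 b)
desc-valid-reduced n b b<n rewrite desc-descW 1 b =
  inBand-valid ℕP.≤-refl bound (descW-inBand 1 (b ∸ 1)) , descW-reduced n 1 (b ∸ 1) ℕP.≤-refl bound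
  where
  bound : 1 +ⁿ (b ∸ 1) ≤ n
  bound = ℕP.≤-trans (s≤s (ℕP.m∸n≤m b 1)) b<n

subword-below : ∀ n {x v} → ValidReduced n v → x ⊆ v → ValidWord n x × x ≤B[ n ] v
subword-below n {x} {v} (valid , reduced) x⊆v =
  All-resp-⊆ x⊆v valid , (v , valid , reduced , (λ _ _ → refl) , x , x⊆v , (λ _ _ → refl))

IsNeg-resp-≗ : ∀ n {v v'} → v ≗ v' → IsNeg n v → IsNeg n v'
IsNeg-resp-≗ n v≗v' (c , d , v≡) = c , d , λ m → trans (sym (v≗v' m)) (v≡ m)

act-e-sum : ∀ n u a b → act n u (e a ⊕ e b) ≗ ⟦ perm n u (true , a) ⟧ ⊕ ⟦ perm n u (true , b) ⟧
act-e-sum n u a b m =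
  trans (act-⊕ n u (e a) (e b) m) (cong₂ _+ᶻ_ (act-signed n u (true , a) m) (act-signed n u (true , b) m))

image-negative : ∀ n u w i → i ≤ n → u ≈[ n ] w → IsNeg n (act n w (γ₂ n i)) → ImageNegative n u i
image-negative n u w i i≤n u≈w wγ₂<0 k 1≤k image≡ =
  not-negative-double n k u2eᵢ<0 (λ m → cong (λ σ → ⟦ σ ⟧ m +ᶻ ⟦ σ ⟧ m) image≡) 1≤k
  where
  u2eᵢ<0 : IsNeg n (⟦ perm n u (true , i) ⟧ ⊕ ⟦ perm n u (true , i) ⟧)
  u2eᵢ<0 = IsNeg-resp-≗ n
    (λ m → trans (sym (u≈w (γ₂ n i) m)) (trans (act-cong n u (γ₂-coords n i i≤n) m) (act-e-sum n u i i m))) wγ₂<0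

no-inversion : ∀ n u w i j → i ≤ j → j ≤ n → u ≈[ n ] w → IsNeg n (act n w (γ₁ n i j)) → NoInversion n u i j
no-inversion n u w i j i≤j j≤n u≈w wγ₁<0 k q image-i image-j 1≤q q<k =
  not-negative-ascent n k q ueᵢ+eⱼ<0 (λ m → cong₂ (λ σ τ → ⟦ σ ⟧ m +ᶻ ⟦ τ ⟧ m) image-i image-j) 1≤q q<k
  where
  ueᵢ+eⱼ<0 : IsNeg n (⟦ perm n u (true , i) ⟧ ⊕ ⟦ perm n u (true , j) ⟧)
  ueᵢ+eⱼ<0 = IsNeg-resp-≗ n
    (λ m → trans (sym (u≈w (γ₁ n i j) m)) (trans (act-cong n u (γ₁-coords n i j i≤j j≤n) m) (act-e-sum n u i j m))) wγ₁<0

proposition3p3 : (n i j : ℕ) → 1 < n → 1 ≤ i → i < j → j ≤ n →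
  (w : List Gen) → ValidWord n w → w ≤B[ n ] w₀ n →
  IsNeg n (act n w (γ₁ n i j)) → IsNeg n (act n w (γ₂ n i)) →
  Σ (List Gen) λ w₁' → Σ (List Gen) λ w₂' →
    ValidWord n w₁' × ValidWord n w₂' ×
    w ≈[ n ] (w₁' ++ middle n i j ++ w₂') ×
    w₁' ≤B[ n ] asc 1 (j ∸ 1) ×
    w₂' ≤B[ n ] desc 1 (i ∸ 1)
proposition3p3 (suc (suc n'')) (suc i') (suc (suc j'')) _ (s≤s z≤n) (s≤s (s≤s i'≤j'')) (s≤s (s≤s j''≤n''))
  w _ (u , u-valid , u-reduced , u≈w₀ , u' , u'⊆u , u'≈w) wγ₁<0 wγ₂<0 =
  left , right , proj₁ left-below , proj₁ right-below , w≈ , proj₂ left-below , proj₂ right-below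
  where
  n i j : ℕ
  n = suc (suc n'')
  i = suc i'
  j = suc (suc j'')
  i≤n : i ≤ n
  i≤n = s≤s (ℕP.≤-trans i'≤j'' (ℕP.≤-trans j''≤n'' (ℕP.n≤1+n n'')))
  -- the reduced word u for w₀ is w₀W itself, so u' is a subword of w₀W
  u'⊆w₀W : u' ⊆ w₀W (suc n'')
  u'⊆w₀W = subst (u' ⊆_) (reduced-w₀ (suc n'') u u-valid u-reduced u≈w₀) u'⊆u
  open MiddleShape (w₀-subword-shape n'' i' j'' i'≤j'' j''≤n'' u'
    (image-negative n u' w i i≤n u'≈w wγ₂<0)
    (no-inversion n u' w i j (ℕP.≤-trans (ℕP.n≤1+n i) (s≤s (s≤s i'≤j''))) (s≤s (s≤s j''≤n'')) u'≈w wγ₁<0)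
    u'⊆w₀W)
  w≈ : w ≈[ n ] (left ++ middle n i j ++ right)
  w≈ x m = trans (sym (u'≈w x m)) (cong (λ v → act n v x m) decomposition)
  left-below : ValidWord n left × left ≤B[ n ] asc 1 (j ∸ 1)
  left-below = subword-below n (asc-valid-reduced n (suc j'') (s≤s (s≤s j''≤n''))) left-⊆
  right-below : ValidWord n right × right ≤B[ n ] desc 1 (i ∸ 1)
  right-below = subword-below n (desc-valid-reduced n i' i≤n) right-⊆
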